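{- Let $G$ be a graph and let $F,H:V(G)\to 2^{\mathbb{N}}$ be such that $(G,H)$ is dense and $F(v)=[0,d_G(v)]\setminus H(v)$ for all $v\in V(G)$. If $|F(v)|\le \frac{1}{2}(d_G(v)-1)$ for every $v\in V(G)$, then $G$ admits an $H$-orientation.
   Context: $G$ has no loops; $[s,t]=\{s,\dots,t\}$. An $H$-orientation is an orientation $O$ of $G$ with out-degree $d^+_O(v)\in H(v)$ for all $v$. The pair $(G,H)$ is dense if $G$ is connected and for every $v\in V(G)$ and every integer $i$ with $0\le i\le d_G(v)-1$: if $i\notin H(v)$ then $i+1\in H(v)$. -}

module Defs where

open import Data.Nat using (ℕ; zero; suc; _+_; _*_; _<_; _≤_)
open import Data.Fin using (Fin; zero; suc; _≟_)
open import Data.Bool using (Bool; true; false; if_then_else_)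
open import Data.Product using (_×_; _,_; proj₁; proj₂; Σ)
open import Relation.Nullary using (¬_; does)
open import Relation.Binary.PropositionalEquality using (_≡_; _≢_)

countFin : ∀ {m} → (Fin m → Bool) → ℕ
countFin {zero}  p = 0
countFin {suc m} p = (if p zero then 1 else 0) + countFin (λ i → p (suc i))

countUpTo : ℕ → (ℕ → Bool) → ℕ
countUpTo zero    p = if p zero then 1 else 0
countUpTo (suc d) p = (if p (suc d) then 1 else 0) + countUpTo d p

record Graph : Set where
  field
    n     : ℕ
    m     : ℕ
    ends  : Fin m → Fin n × Fin n
    noLoop : ∀ e → proj₁ (ends e) ≢ proj₂ (ends e)
open Graph public

Vertex : Graph → Set
Vertex G = Fin (n G)

incident : (G : Graph) → Vertex G → Fin (m G) → Bool
incident G v e with does (v ≟ proj₁ (ends G e)) | does (v ≟ proj₂ (ends G e))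
... | false | false = false
... | _     | _     = true

deg : (G : Graph) → Vertex G → ℕ
deg G v = countFin (incident G v)

data Reach (G : Graph) : Vertex G → Vertex G → Set where
  here : ∀ {v} → Reach G v v
  fwd  : ∀ {v} (e : Fin (m G)) → Reach G v (proj₁ (ends G e)) → Reach G v (proj₂ (ends G e))
  bwd  : ∀ {v} (e : Fin (m G)) → Reach G v (proj₂ (ends G e)) → Reach G v (proj₁ (ends G e))

Connected : Graph → Set
Connected G = ∀ (u v : Vertex G) → Reach G u v

-- orientation: O e = true means e is directed proj₁ → proj₂, false means proj₂ → proj₁
Orientation : Graph → Set
Orientation G = Fin (m G) → Bool

tail : (G : Graph) → Orientation G → Fin (m G) → Vertex G
tail G O e = if O e then proj₁ (ends G e) else proj₂ (ends G e)

outdeg : (G : Graph) → Orientation G → Vertex G → ℕ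
outdeg G O v = countFin (λ e → does (v ≟ tail G O e))

-- subsets of ℕ given by characteristic functions
-- H-orientation: d⁺_O(v) ∈ H(v) for all v
IsHOrientation : (G : Graph) → (Vertex G → ℕ → Bool) → Orientation G → Set
IsHOrientation G H O = ∀ v → H v (outdeg G O v) ≡ true

Dense : (G : Graph) → (Vertex G → ℕ → Bool) → Set
Dense G H = Connected G ×
  (∀ v (i : ℕ) → suc i ≤ deg G v → H v i ≡ false → H v (suc i) ≡ true)

Fset : (G : Graph) → (Vertex G → ℕ → Bool) → Vertex G → ℕ → Bool
Fset G H v i = if H v i then false else true

cardF : (G : Graph) → (Vertex G → ℕ → Bool) → Vertex G → ℕ
cardF G H v = countUpTo (deg G v) (Fset G H v)

module Submission where

-- Call a set h admissible for degree d ≥ 1 if it has no two consecutive gaps below d and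
-- contains two consecutive values i, i + 1 ≤ d (for d = 0 just require 0 ∈ h). Density and
-- |F(v)| ≤ (d(v) − 1)/2 make every H(v) admissible. Admissible constraints are satisfiable,
-- via a stronger claim proved by induction on the number of edges: if the constraints are
-- admissible away from a non-isolated vertex r, two orientations satisfy them away from r and
-- have consecutive out-degrees at r; density at r then accepts one of the two. For the
-- induction step delete an edge rw. Directing rw out of w shifts the constraint at w by one,
-- and one of the two shifts keeps it admissible. If r becomes isolated, the direction of rw
-- alone decides the out-degree of r, and a split at w (or, if w is isolated too, any
-- solution) serves both directions.

open import Defs
open import Data.Nat using (ℕ; _+_; _*_; _≤_)
open import Data.Bool using (Bool)
open import Data.Product using (Σ)

open import Algebra.Properties.CommutativeSemigroup using (x∙yz≈y∙xz)
open import Data.Bool using (true; false; _∨_; if_then_else_)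
open import Data.Bool.Properties using (∨-comm; ∨-zeroʳ)
open import Data.Empty using (⊥-elim)
open import Data.Fin using (Fin; zero; suc; punchIn; _≟_)
open import Data.Fin.Properties using (¬Fin0; any?)
open import Data.Nat using (zero; suc; pred; z≤n; s≤s; _<_; _≤?_)
open import Data.Nat.Properties
  using ( ≤-refl; ≤-trans; m≤n⇒m≤1+n; m≤n⇒m<n∨m≡n; m≤n+m; n≤0⇒n≡0; ≮⇒≥; n≮n
        ; +-suc; +-comm; *-suc; +-commutativeSemigroup)
open import Data.Product using (∃; _×_; _,_; proj₁; proj₂)
open import Data.Sum using (_⊎_; inj₁; inj₂)
open import Data.Vec.Functional using (insertAt; updateAt)
open import Data.Vec.Functional.Properties
  using (insertAt-punchIn; insertAt-lookup; updateAt-updates; updateAt-minimal)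
open import Function using (_∘_; const)
open import Relation.Nullary using (Dec; yes; no; does; contradiction)
open import Relation.Nullary.Decidable using (dec-true; dec-false)
open import Relation.Binary.PropositionalEquality

𝟙 : Bool → ℕ
𝟙 b = if b then 1 else 0

countFin-cong : ∀ {k} {p q : Fin k → Bool} → (∀ i → p i ≡ q i) → countFin p ≡ countFin q
countFin-cong {zero}  p≗q = refl
countFin-cong {suc k} p≗q = cong₂ _+_ (cong 𝟙 (p≗q zero)) (countFin-cong (p≗q ∘ suc))

countFin-mono : ∀ {k} {p q : Fin k → Bool} →
                (∀ i → p i ≡ true → q i ≡ true) → countFin p ≤ countFin q
countFin-mono {zero}          p⊆q = z≤n
countFin-mono {suc k} {p} {q} p⊆q with p zero | q zero | p⊆q zero
... | true  | true  | _ = s≤s (countFin-mono (p⊆q ∘ suc))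
... | true  | false | f with () ← f refl
... | false | true  | _ = m≤n⇒m≤1+n (countFin-mono (p⊆q ∘ suc))
... | false | false | _ = countFin-mono (p⊆q ∘ suc)

countFin-witness : ∀ {k} (p : Fin k → Bool) → 1 ≤ countFin p → ∃ λ i → p i ≡ true
countFin-witness {suc k} p pos with p zero in p0
... | true  = zero , p0
... | false with i , pi ← countFin-witness (p ∘ suc) pos = suc i , pi

countFin-punchIn : ∀ {k} (p : Fin (suc k) → Bool) e →
                   countFin p ≡ 𝟙 (p e) + countFin (p ∘ punchIn e)
countFin-punchIn         p zero    = refl
countFin-punchIn {suc k} p (suc e) =
  trans (cong (𝟙 (p zero) +_) (countFin-punchIn (p ∘ suc) e))
        (x∙yz≈y∙xz +-commutativeSemigroup (𝟙 (p zero)) (𝟙 (p (suc e))) _)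

DenseAt : ℕ → (ℕ → Bool) → Set
DenseAt d h = ∀ i → i < d → h i ≡ false → h (suc i) ≡ true

HasPair : ℕ → (ℕ → Bool) → Set
HasPair d h = ∃ λ i → suc i ≤ d × h i ≡ true × h (suc i) ≡ true

Admissible : ℕ → (ℕ → Bool) → Set
Admissible zero    h = h 0 ≡ true
Admissible (suc d) h = DenseAt (suc d) h × HasPair (suc d) h

WeaklyAdmissible : ℕ → (ℕ → Bool) → Set
WeaklyAdmissible zero    h = h 0 ≡ true
WeaklyAdmissible (suc d) h = DenseAt (suc d) h

dense-consecutive : ∀ {d h} → DenseAt d h → ∀ {x} → x < d → h x ≡ true ⊎ h (suc x) ≡ true
dense-consecutive {h = h} dense {x} x<d with h x in hx
... | true  = inj₁ refl
... | false = inj₂ (dense x x<d hx)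

dense-pred : ∀ {d h} → DenseAt (suc d) h → DenseAt d h
dense-pred dense i i<d = dense i (m≤n⇒m≤1+n i<d)

dense-suc : ∀ {d h} → DenseAt (suc d) h → DenseAt d (h ∘ suc)
dense-suc dense i i<d = dense (suc i) (s≤s i<d)

admissible⇒dense : ∀ d {h} → Admissible d h → DenseAt d h
admissible⇒dense zero    _           i ()
admissible⇒dense (suc d) (dense , _) = dense

dense-pair⇒admissible : ∀ d {h} → DenseAt d h → HasPair d h → Admissible d h
dense-pair⇒admissible (suc d) dense pair = dense , pair

admissible-shrink : ∀ d {h} → Admissible (suc d) h → Admissible d h ⊎ Admissible d (h ∘ suc)
admissible-shrink zero    (_ , zero , _ , _ , h1)    = inj₂ h1
admissible-shrink zero    (_ , suc _ , s≤s () , _)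
admissible-shrink (suc d) (dense , i , s≤s i≤1+d , hi , hi+1) with m≤n⇒m<n∨m≡n i≤1+d
... | inj₁ i<1+d = inj₁ (dense-pred dense , i , i<1+d , hi , hi+1)
... | inj₂ refl  = inj₂ (dense-suc dense , d , ≤-refl , hi , hi+1)

admissible-suc⇒weakly : ∀ d {h} → Admissible (suc d) h →
                        WeaklyAdmissible d h × WeaklyAdmissible d (h ∘ suc)
admissible-suc⇒weakly zero    (_ , zero , _ , h0 , h1) = h0 , h1
admissible-suc⇒weakly zero    (_ , suc _ , s≤s () , _)
admissible-suc⇒weakly (suc d) (dense , _)             = dense-pred dense , dense-suc dense

-- punchIn and insertAt re-indexed by Fin k and Fin (pred k), so that deleting an
-- edge of an arbitrary graph leaves its vertex set unchanged definitionally.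
punchIn′ : ∀ {k} → Fin k → Fin (pred k) → Fin k
punchIn′ {suc k} e i = punchIn e i

insertAt′ : ∀ {k} {A : Set} → (Fin (pred k) → A) → Fin k → A → Fin k → A
insertAt′ {suc k} xs e a = insertAt xs e a

countFin-punchIn′ : ∀ {k} (p : Fin k → Bool) (e : Fin k) →
                    countFin p ≡ 𝟙 (p e) + countFin (p ∘ punchIn′ e)
countFin-punchIn′ {suc k} p e = countFin-punchIn p e

insertAt′-punchIn′ : ∀ {k} {A : Set} (xs : Fin (pred k) → A) (e : Fin k) a i →
                     insertAt′ xs e a (punchIn′ e i) ≡ xs i
insertAt′-punchIn′ {suc k} xs e a i = insertAt-punchIn xs e a i

insertAt′-lookup : ∀ {k} {A : Set} (xs : Fin (pred k) → A) (e : Fin k) a → insertAt′ xs e a e ≡ a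
insertAt′-lookup {suc k} xs e a = insertAt-lookup xs e a

_∖_ : (G : Graph) → Fin (m G) → Graph
G ∖ e = record
  { n      = n G
  ; m      = pred (m G)
  ; ends   = ends G ∘ punchIn′ e
  ; noLoop = noLoop G ∘ punchIn′ e
  }

∖-induction : (P : Graph → Set) → (∀ G → (∀ e → P (G ∖ e)) → P G) → ∀ G → P G
∖-induction P step G = go (m G) G refl
  where
  go : ∀ k G → m G ≡ k → P G
  go zero    G m≡0   = step G λ e → ⊥-elim (¬Fin0 (subst Fin m≡0 e))
  go (suc k) G m≡1+k = step G λ e → go k (G ∖ e) (cong pred m≡1+k)

incident-≡-∨ : ∀ G v e →
               incident G v e ≡ does (v ≟ proj₁ (ends G e)) ∨ does (v ≟ proj₂ (ends G e))
incident-≡-∨ G v e with does (v ≟ proj₁ (ends G e)) | does (v ≟ proj₂ (ends G e))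
... | false | false = refl
... | false | true  = refl
... | true  | _     = refl

deg-∖ : ∀ G e v → deg G v ≡ 𝟙 (incident G v e) + deg (G ∖ e) v
deg-∖ G e v = trans (countFin-punchIn′ (incident G v) e) (cong (𝟙 (incident G v e) +_)
  (countFin-cong λ i → trans (incident-≡-∨ G v (punchIn′ e i)) (sym (incident-≡-∨ (G ∖ e) v i))))

tail-incident : ∀ G O v e → does (v ≟ tail G O e) ≡ true → incident G v e ≡ true
tail-incident G O v e v≡tail with O e
... | true  = trans (incident-≡-∨ G v e) (cong (_∨ does (v ≟ proj₂ (ends G e))) v≡tail)
... | false = trans (incident-≡-∨ G v e)
                    (trans (cong (does (v ≟ proj₁ (ends G e)) ∨_) v≡tail) (∨-zeroʳ _))

outdeg≤deg : ∀ G O v → outdeg G O v ≤ deg G v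
outdeg≤deg G O v = countFin-mono (tail-incident G O v)

isolated⇒outdeg≡0 : ∀ G O v → deg G v ≡ 0 → outdeg G O v ≡ 0
isolated⇒outdeg≡0 G O v deg≡0 = n≤0⇒n≡0 (subst (outdeg G O v ≤_) deg≡0 (outdeg≤deg G O v))

Constraints : Graph → Set
Constraints G = Vertex G → ℕ → Bool

GoodAt : (G : Graph) → Constraints G → Orientation G → Vertex G → Set
GoodAt G H O v = H v (outdeg G O v) ≡ true

GoodOff : (G : Graph) → Constraints G → Orientation G → Vertex G → Set
GoodOff G H O r = ∀ x → x ≢ r → GoodAt G H O x

record Split (G : Graph) (H : Constraints G) (r : Vertex G) : Set where
  field
    lower upper : Orientation G
    lower-good  : GoodOff G H lower r
    upper-good  : GoodOff G H upper r
    upper-step  : outdeg G upper r ≡ suc (outdeg G lower r)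

outdeg-cong : ∀ G {O O′ : Orientation G} → (∀ e → O e ≡ O′ e) →
              ∀ v → outdeg G O v ≡ outdeg G O′ v
outdeg-cong G O≗O′ v = countFin-cong λ e → cong (λ b → does (v ≟ (if b then _ else _))) (O≗O′ e)

outdeg-∖ : ∀ G e O v →
           outdeg G O v ≡ 𝟙 (does (v ≟ tail G O e)) + outdeg (G ∖ e) (O ∘ punchIn′ e) v
outdeg-∖ G e O v = countFin-punchIn′ (λ e → does (v ≟ tail G O e)) e

data Joins (G : Graph) (e : Fin (m G)) (u v : Vertex G) : Set where
  forward  : ends G e ≡ (u , v) → Joins G e u v
  backward : ends G e ≡ (v , u) → Joins G e u v

module _ {G : Graph} {e : Fin (m G)} where

  joins-sym : ∀ {u v} → Joins G e u v → Joins G e v u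
  joins-sym (forward p)  = backward p
  joins-sym (backward p) = forward p

  joins⇒≢ : ∀ {u v} → Joins G e u v → u ≢ v
  joins⇒≢ (forward p)  u≡v = noLoop G e (trans (cong proj₁ p) (trans u≡v (sym (cong proj₂ p))))
  joins⇒≢ (backward p) u≡v = noLoop G e (trans (cong proj₁ p) (trans (sym u≡v) (sym (cong proj₂ p))))

  incident-joins : ∀ {u v} → Joins G e u v → ∀ x → incident G x e ≡ does (x ≟ u) ∨ does (x ≟ v)
  incident-joins (forward p) x =
    trans (incident-≡-∨ G x e) (cong (λ uv → does (x ≟ proj₁ uv) ∨ does (x ≟ proj₂ uv)) p)
  incident-joins {u} {v} (backward p) x =
    trans (incident-≡-∨ G x e) (trans (cong (λ uv → does (x ≟ proj₁ uv) ∨ does (x ≟ proj₂ uv)) p)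
                                      (∨-comm (does (x ≟ v)) (does (x ≟ u))))

  incident⇒joins : ∀ {u} → incident G u e ≡ true → ∃ (Joins G e u)
  incident⇒joins {u} inc =
    endpoint (u ≟ proj₁ (ends G e)) (u ≟ proj₂ (ends G e)) (trans (sym (incident-≡-∨ G u e)) inc)
    where
    endpoint : (u≟₁ : Dec (u ≡ proj₁ (ends G e))) (u≟₂ : Dec (u ≡ proj₂ (ends G e))) →
               does u≟₁ ∨ does u≟₂ ≡ true → ∃ (Joins G e u)
    endpoint (yes p) _       _ = proj₂ (ends G e) , forward (cong (_, proj₂ (ends G e)) (sym p))
    endpoint (no _)  (yes q) _ = proj₁ (ends G e) , backward (cong (proj₁ (ends G e) ,_) (sym q))

  deg-∖-endpoint : ∀ {u v} → Joins G e u v → deg G u ≡ suc (deg (G ∖ e) u)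
  deg-∖-endpoint {u} {v} j = trans (deg-∖ G e u)
    (cong (λ b → 𝟙 b + deg (G ∖ e) u)
          (trans (incident-joins j u) (cong (_∨ does (u ≟ v)) (dec-true (u ≟ u) refl))))

  deg-∖-other : ∀ {u v x} → Joins G e u v → x ≢ u → x ≢ v → deg G x ≡ deg (G ∖ e) x
  deg-∖-other {u} {v} {x} j x≢u x≢v = trans (deg-∖ G e x)
    (cong (λ b → 𝟙 b + deg (G ∖ e) x)
          (trans (incident-joins j x) (cong₂ _∨_ (dec-false (x ≟ u) x≢u) (dec-false (x ≟ v) x≢v))))

  orientFrom : ∀ {u v} → Joins G e u v → Orientation (G ∖ e) → Orientation G
  orientFrom (forward _)  O = insertAt′ O e true
  orientFrom (backward _) O = insertAt′ O e false

  tail-orientFrom : ∀ {u v} (j : Joins G e u v) O → tail G (orientFrom j O) e ≡ u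
  tail-orientFrom (forward p) O =
    trans (cong (λ b → if b then _ else _) (insertAt′-lookup O e true)) (cong proj₁ p)
  tail-orientFrom (backward p) O =
    trans (cong (λ b → if b then _ else _) (insertAt′-lookup O e false)) (cong proj₂ p)

  orientFrom-punchIn′ : ∀ {u v} (j : Joins G e u v) O i → orientFrom j O (punchIn′ e i) ≡ O i
  orientFrom-punchIn′ (forward _)  O = insertAt′-punchIn′ O e true
  orientFrom-punchIn′ (backward _) O = insertAt′-punchIn′ O e false

  outdeg-orientFrom : ∀ {u v} (j : Joins G e u v) O x →
                      outdeg G (orientFrom j O) x ≡ 𝟙 (does (x ≟ u)) + outdeg (G ∖ e) O x
  outdeg-orientFrom j O x = trans (outdeg-∖ G e (orientFrom j O) x)
    (cong₂ _+_ (cong (λ t → 𝟙 (does (x ≟ t))) (tail-orientFrom j O))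
               (outdeg-cong (G ∖ e) (orientFrom-punchIn′ j O) x))

  outdeg-orientFrom-source : ∀ {u v} (j : Joins G e u v) O →
                             outdeg G (orientFrom j O) u ≡ suc (outdeg (G ∖ e) O u)
  outdeg-orientFrom-source {u} j O =
    trans (outdeg-orientFrom j O u) (cong (λ b → 𝟙 b + outdeg (G ∖ e) O u) (dec-true (u ≟ u) refl))

  outdeg-orientFrom-other : ∀ {u v x} (j : Joins G e u v) O → x ≢ u →
                            outdeg G (orientFrom j O) x ≡ outdeg (G ∖ e) O x
  outdeg-orientFrom-other {u} {x = x} j O x≢u =
    trans (outdeg-orientFrom j O x) (cong (λ b → 𝟙 b + outdeg (G ∖ e) O x) (dec-false (x ≟ u) x≢u))

  -- Directing e out of u raises the out-degree of u by one, so u's constraint is shifted.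
  good-orientFrom : ∀ {H u v} (j : Joins G e u v) O x →
                    GoodAt (G ∖ e) (updateAt H u (_∘ suc)) O x → GoodAt G H (orientFrom j O) x
  good-orientFrom {H} {u} j O x good with x ≟ u
  ... | yes refl = subst (λ k → H x k ≡ true) (sym (outdeg-orientFrom-source j O))
                     (subst (λ h → h (outdeg (G ∖ e) O x) ≡ true) (updateAt-updates x H) good)
  ... | no x≢u   = subst (λ k → H x k ≡ true) (sym (outdeg-orientFrom-other j O x≢u))
                     (subst (λ h → h (outdeg (G ∖ e) O x) ≡ true) (updateAt-minimal x u H x≢u) good)

  split-orientFrom : ∀ {H u v r} (j : Joins G e u v) →
                     Split (G ∖ e) (updateAt H u (_∘ suc)) r → Split G H r
  split-orientFrom {u = u} {r = r} j s = record
    { lower      = orientFrom j lower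
    ; upper      = orientFrom j upper
    ; lower-good = λ x x≢r → good-orientFrom j lower x (lower-good x x≢r)
    ; upper-good = λ x x≢r → good-orientFrom j upper x (upper-good x x≢r)
    ; upper-step = begin
        outdeg G (orientFrom j upper) r                  ≡⟨ outdeg-orientFrom j upper r ⟩
        𝟙 (does (r ≟ u)) + outdeg (G ∖ e) upper r        ≡⟨ cong (𝟙 (does (r ≟ u)) +_) upper-step ⟩
        𝟙 (does (r ≟ u)) + suc (outdeg (G ∖ e) lower r)  ≡⟨ +-suc _ _ ⟩
        suc (𝟙 (does (r ≟ u)) + outdeg (G ∖ e) lower r)  ≡⟨ cong suc (outdeg-orientFrom j lower r) ⟨
        suc (outdeg G (orientFrom j lower) r)            ∎
    }
    where
    open Split s
    open ≡-Reasoning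

AdmissibleAt : (G : Graph) → Constraints G → Vertex G → Set
AdmissibleAt G H v = Admissible (deg G v) (H v)

Orientable : Graph → Set
Orientable G = ∀ H → (∀ v → AdmissibleAt G H v) → Σ (Orientation G) (IsHOrientation G H)

Splittable : Graph → Set
Splittable G = ∀ H r → (∀ x → x ≢ r → AdmissibleAt G H x) → 1 ≤ deg G r → Split G H r

goodOff⇒good : ∀ G H O r → GoodOff G H O r → GoodAt G H O r → IsHOrientation G H O
goodOff⇒good G H O r off at v with v ≟ r
... | yes refl = at
... | no v≢r   = off v v≢r

isolated⇒good : ∀ G H O v → deg G v ≡ 0 → AdmissibleAt G H v → GoodAt G H O v
isolated⇒good G H O v deg≡0 adm =
  subst (λ k → H v k ≡ true) (sym (isolated⇒outdeg≡0 G O v deg≡0))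
        (subst (λ d → Admissible d (H v)) deg≡0 adm)

split-resolve : ∀ {G H r} → Split G H r → DenseAt (deg G r) (H r) →
                Σ (Orientation G) (IsHOrientation G H)
split-resolve {G} {H} {r} s dense = choose (dense-consecutive dense lower<deg)
  where
  open Split s
  lower<deg : outdeg G lower r < deg G r
  lower<deg = subst (_≤ deg G r) upper-step (outdeg≤deg G upper r)
  choose : H r (outdeg G lower r) ≡ true ⊎ H r (suc (outdeg G lower r)) ≡ true →
           Σ (Orientation G) (IsHOrientation G H)
  choose (inj₁ at-lower) = lower , goodOff⇒good G H lower r lower-good at-lower
  choose (inj₂ at-upper) =
    upper , goodOff⇒good G H upper r upper-good (subst (λ k → H r k ≡ true) (sym upper-step) at-upper)

orientable : ∀ G → Splittable G → Orientable G
orientable G split H adm with any? (λ v → 1 ≤? deg G v)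
... | yes (r , r-pos) =
  split-resolve (split H r (λ x _ → adm x) r-pos) (admissible⇒dense (deg G r) (adm r))
... | no no-edges     =
  const true , λ v → isolated⇒good G H (const true) v (isolated v) (adm v)
  where
  isolated : ∀ v → deg G v ≡ 0
  isolated v = n≤0⇒n≡0 (≮⇒≥ λ pos → no-edges (v , pos))

orientable-weakly : ∀ G → Splittable G → ∀ H w → (∀ x → x ≢ w → AdmissibleAt G H x) →
                    WeaklyAdmissible (deg G w) (H w) → Σ (Orientation G) (IsHOrientation G H)
orientable-weakly G split H w adm = by-degree (deg G w) refl
  where
  by-degree : ∀ d → deg G w ≡ d → WeaklyAdmissible d (H w) → Σ (Orientation G) (IsHOrientation G H)
  by-degree zero deg≡0 hw0 = orientable G split H adm′
    where
    adm′ : ∀ x → AdmissibleAt G H x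
    adm′ x with x ≟ w
    ... | yes refl = subst (λ d → Admissible d (H w)) (sym deg≡0) hw0
    ... | no x≢w   = adm x x≢w
  by-degree (suc d) deg≡1+d dense =
    split-resolve (split H w adm (subst (1 ≤_) (sym deg≡1+d) (s≤s z≤n)))
                  (subst (λ d → DenseAt d (H w)) (sym deg≡1+d) dense)

module SplitStep (G : Graph) (split′ : ∀ e → Splittable (G ∖ e)) (H : Constraints G) (r : Vertex G)
                 (adm : ∀ x → x ≢ r → AdmissibleAt G H x) {e : Fin (m G)} {w : Vertex G}
                 (j : Joins G e r w) where

  G′ : Graph
  G′ = G ∖ e

  r≢w : r ≢ w
  r≢w = joins⇒≢ j

  w≢r : w ≢ r
  w≢r = joins⇒≢ (joins-sym j)

  w-admissible : Admissible (suc (deg G′ w)) (H w)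
  w-admissible = subst (λ d → Admissible d (H w)) (deg-∖-endpoint (joins-sym j)) (adm w w≢r)

  AgreesAway : Constraints G′ → Set
  AgreesAway K = ∀ x → x ≢ r → x ≢ w → K x ≡ H x

  shift-r-agrees : AgreesAway (updateAt H r (_∘ suc))
  shift-r-agrees x x≢r _ = updateAt-minimal x r H x≢r

  shift-w-agrees : AgreesAway (updateAt H w (_∘ suc))
  shift-w-agrees x _ x≢w = updateAt-minimal x w H x≢w

  admissible-away : ∀ K → AgreesAway K → ∀ x → x ≢ r → x ≢ w → AdmissibleAt G′ K x
  admissible-away K agree x x≢r x≢w =
    subst₂ Admissible (deg-∖-other j x≢r x≢w) (sym (agree x x≢r x≢w)) (adm x x≢r)

  admissible-off-r : ∀ K → AgreesAway K → Admissible (deg G′ w) (K w) →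
                     ∀ x → x ≢ r → AdmissibleAt G′ K x
  admissible-off-r K agree adm-w x x≢r with x ≟ w
  ... | yes refl = adm-w
  ... | no x≢w   = admissible-away K agree x x≢r x≢w

  split-non-isolated : 1 ≤ deg G′ r → Split G H r
  split-non-isolated r-pos with admissible-shrink (deg G′ w) w-admissible
  ... | inj₁ adm-w =
    split-orientFrom j (split′ e _ r (admissible-off-r _ shift-r-agrees
      (subst (Admissible _) (sym (updateAt-minimal w r H w≢r)) adm-w)) r-pos)
  ... | inj₂ adm-w∘suc =
    split-orientFrom (joins-sym j) (split′ e _ r (admissible-off-r _ shift-w-agrees
      (subst (Admissible _) (sym (updateAt-updates w H)) adm-w∘suc)) r-pos)

  good-off-isolated : deg G′ r ≡ 0 → ∀ K → AgreesAway K → WeaklyAdmissible (deg G′ w) (K w) →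
                      Σ (Orientation G′) (λ O → GoodOff G′ K O r)
  good-off-isolated r-isolated K agree weak-w =
    O , λ x x≢r → subst (λ h → h (outdeg G′ O x) ≡ true) (updateAt-minimal x r K x≢r) (good x)
    where
    -- r is isolated in G′, so freeing its constraint changes nothing away from r.
    K′ : Constraints G′
    K′ = updateAt K r (const (const true))
    adm′ : ∀ x → x ≢ w → AdmissibleAt G′ K′ x
    adm′ x x≢w with x ≟ r
    ... | yes refl = subst₂ Admissible (sym r-isolated) (sym (updateAt-updates r K)) refl
    ... | no x≢r   =
      subst (Admissible _) (sym (updateAt-minimal x r K x≢r)) (admissible-away K agree x x≢r x≢w)
    oriented : Σ (Orientation G′) (IsHOrientation G′ K′)
    oriented = orientable-weakly G′ (split′ e) K′ w adm′
                 (subst (WeaklyAdmissible _) (sym (updateAt-minimal w r K w≢r)) weak-w)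
    O = proj₁ oriented
    good = proj₂ oriented

  split-isolated : deg G′ r ≡ 0 → Split G H r
  split-isolated r-isolated = record
    { lower      = orientFrom j′ O-w
    ; upper      = orientFrom j O-r
    ; lower-good = λ x x≢r → good-orientFrom j′ O-w x (good-w x x≢r)
    ; upper-good = λ x x≢r → good-orientFrom j O-r x (good-r x x≢r)
    ; upper-step = begin
        outdeg G (orientFrom j O-r) r                    ≡⟨ outdeg-orientFrom-source j O-r ⟩
        suc (outdeg G′ O-r r)                            ≡⟨ cong suc (out-r≡0 O-r) ⟩
        1                                                ≡⟨ cong suc (out-r≡0 O-w) ⟨
        suc (outdeg G′ O-w r)                            ≡⟨ cong suc (outdeg-orientFrom-other j′ O-w r≢w) ⟨
        suc (outdeg G (orientFrom j′ O-w) r)             ∎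
    }
    where
    open ≡-Reasoning
    j′ = joins-sym j
    out-r≡0 : ∀ O → outdeg G′ O r ≡ 0
    out-r≡0 O = isolated⇒outdeg≡0 G′ O r r-isolated
    weak = admissible-suc⇒weakly (deg G′ w) w-admissible
    from-r = good-off-isolated r-isolated _ shift-r-agrees
               (subst (WeaklyAdmissible _) (sym (updateAt-minimal w r H w≢r)) (proj₁ weak))
    from-w = good-off-isolated r-isolated _ shift-w-agrees
               (subst (WeaklyAdmissible _) (sym (updateAt-updates w H)) (proj₂ weak))
    O-r = proj₁ from-r
    good-r = proj₂ from-r
    O-w = proj₁ from-w
    good-w = proj₂ from-w

  split : Split G H r
  split with deg G′ r in deg′-r
  ... | zero  = split-isolated deg′-r
  ... | suc _ = split-non-isolated (subst (1 ≤_) (sym deg′-r) (s≤s z≤n))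

splittable : ∀ G → Splittable G
splittable = ∖-induction Splittable λ G split′ H r adm r-pos →
  let e , r∈e = countFin-witness (incident G r) r-pos
      w , j   = incident⇒joins r∈e
  in  SplitStep.split G split′ H r adm j

missing : (ℕ → Bool) → ℕ → Bool
missing h i = if h i then false else true

-- Without a pair of consecutive members, every member of h ∩ [0, d] but the first is
-- preceded by a gap, which forces half of [0, d] to be missing.
pair-or-half-missing : ∀ d h → HasPair d h ⊎ 𝟙 (missing h d) + d ≤ 2 * countUpTo d (missing h)
pair-or-half-missing zero h with h 0
... | true  = inj₂ z≤n
... | false = inj₂ (s≤s z≤n)
pair-or-half-missing (suc d) h with h d in h[d] | h (suc d) in h[1+d] | pair-or-half-missing d h
... | _     | _     | inj₁ (i , i<d , hi , hi+1) = inj₁ (i , m≤n⇒m≤1+n i<d , hi , hi+1)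
... | true  | true  | inj₂ _                     = inj₁ (d , ≤-refl , h[d] , h[1+d])
... | false | true  | inj₂ half                  = inj₂ half
... | _     | false | inj₂ half                  =
  inj₂ (subst (2 + d ≤_) (sym (*-suc 2 _)) (s≤s (s≤s (≤-trans (m≤n+m d _) half))))

few-missing⇒pair : ∀ d h → 2 * countUpTo d (missing h) + 1 ≤ d → HasPair d h
few-missing⇒pair d h few with pair-or-half-missing d h
... | inj₁ pair = pair
... | inj₂ half =
  contradiction (subst (_≤ 2c) (+-comm 2c 1) (≤-trans few (≤-trans (m≤n+m d _) half))) (n≮n 2c)
  where 2c = 2 * countUpTo d (missing h)

corollary3p1 : (G : Graph) (H : Vertex G → ℕ → Bool) →
    Dense G H →
    (∀ v → 2 * cardF G H v + 1 ≤ deg G v) →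
    Σ (Orientation G) (λ O → IsHOrientation G H O)
corollary3p1 G H (_ , dense) few-missing = orientable G (splittable G) H admissible
  where
  admissible : ∀ v → AdmissibleAt G H v
  admissible v =
    dense-pair⇒admissible (deg G v) (dense v) (few-missing⇒pair (deg G v) (H v) (few-missing v))
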